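{- For every indexed container $w$ over $I$, the predicate $\nu_{w^{\ast\bot}}$ (the coinductive predicate for $(w^\ast)^\bot$) is a weakly terminal coalgebra for $[\![w^\bot]\!]$.
   Context: Indexed container $w=\langle A,D,n\rangle$ over $I$, with $i[a/d]=n(i,a,d)$ and extension $i\in[\![w]\!](X)=\sum_{a:A(i)}\prod_{d:D(i,a)}X(i[a/d])$. For $h:X\subseteq Y$, $[\![w]\!]_h\langle a,k\rangle=\langle a,\lambda d.\,h(k\,d)\rangle$. Dual: $A^\bot(i)=\prod_a D(i,a)$, $D^\bot(i,f)=A(i)$, $n^\bot(i,f,a)=i[a/f\,a]$. Free container $w^\ast$: $A^\ast(i)$ is generated by $\mathtt{Leaf}$ and $\mathtt{Node}(a,k)$ with $a:A(i)$, $k:\prod_d A^\ast(i[a/d])$. Further, $D^\ast(i,\mathtt{Leaf})=\mathbf 1$, $n^\ast(i,\mathtt{Leaf},\star)=i$, $D^\ast(i,\mathtt{Node}(a,k))=\sum_d D^\ast(i[a/d],k\,d)$ and $n^\ast(i,\mathtt{Node}(a,k),\langle d,d'\rangle)=n^\ast(i[a/d],k\,d,d')$. $\nu_v$ is the coinductive predicate with $\nu\mathrm{elim}:\nu_v\subseteq[\![v]\!](\nu_v)$, $\nu\mathrm{intro}\,c:X\subseteq\nu_v$ for $c:X\subseteq[\![v]\!](X)$, and $\nu\mathrm{elim}(\nu\mathrm{intro}\,c\,i\,x)=[\![v]\!]_{\nu\mathrm{intro}\,c}\,i\,(c\,i\,x)$. A predicate $T$ on $I$ is a weakly terminal coalgebra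 for $[\![v]\!]$ if there are - $\mathrm{elim}:T\subseteq[\![v]\!](T)$, - for every predicate $X$, a map $\mathrm{intro}:(X\subseteq[\![v]\!](X))\to(X\subseteq T)$, - for all $X$, $c$, $i$ and $x:X(i)$, a proof of $\mathrm{elim}(\mathrm{intro}\,c\,i\,x)\equiv[\![v]\!]_{\mathrm{intro}\,c}\,i\,(c\,i\,x)$. -}

module Defs where

open import Data.Unit using (⊤; tt)
open import Data.Product using (Σ; _,_; proj₁; proj₂)
open import Relation.Binary.PropositionalEquality using (_≡_)

Pred : Set → Set₁
Pred I = I → Set

_⊆_ : {I : Set} → Pred I → Pred I → Set
X ⊆ Y = ∀ i → X i → Y i

record Container (I : Set) : Set₁ where
  constructor ⟨_,_,_⟩
  field
    A : I → Set
    D : (i : I) → A i → Set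
    n : (i : I) (a : A i) → D i a → I
open Container public

⟦_⟧ : {I : Set} → Container I → Pred I → Pred I
⟦ w ⟧ X i = Σ (A w i) λ a → (d : D w i a) → X (n w i a d)

⟦_⟧₁ : {I : Set} (w : Container I) {X Y : Pred I} → X ⊆ Y → ⟦ w ⟧ X ⊆ ⟦ w ⟧ Y
⟦ w ⟧₁ h i (a , k) = a , λ d → h (n w i a d) (k d)

_⊥ : {I : Set} → Container I → Container I
w ⊥ = record
  { A = λ i → (a : A w i) → D w i a
  ; D = λ i f → A w i
  ; n = λ i f a → n w i a (f a)
  }

data A* {I : Set} (w : Container I) : I → Set where
  Leaf : ∀ {i} → A* w i
  Node : ∀ {i} (a : A w i) → ((d : D w i a) → A* w (n w i a d)) → A* w i

D* : {I : Set} (w : Container I) (i : I) → A* w i → Set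
D* w i Leaf = ⊤
D* w i (Node a k) = Σ (D w i a) λ d → D* w (n w i a d) (k d)

n* : {I : Set} (w : Container I) (i : I) (t : A* w i) → D* w i t → I
n* w i Leaf tt = i
n* w i (Node a k) (d , d′) = n* w (n w i a d) (k d) d′

_* : {I : Set} → Container I → Container I
w * = record { A = A* w ; D = D* w ; n = n* w }

record WeaklyTerminal {I : Set} (v : Container I) (T : Pred I) : Set₁ where
  field
    elim  : T ⊆ ⟦ v ⟧ T
    intro : {X : Pred I} → X ⊆ ⟦ v ⟧ X → X ⊆ T
    comp  : {X : Pred I} (c : X ⊆ ⟦ v ⟧ X) (i : I) (x : X i) →
            elim i (intro c i x) ≡ ⟦ v ⟧₁ (intro c) i (c i x)

-- The coinductive predicate ν_v is specified (as in the paper) exactly by the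
-- interface νelim / νintro / computation rule, i.e. it is a predicate T carrying
-- a WeaklyTerminal v T structure.
IsNu : {I : Set} (v : Container I) (T : Pred I) → Set₁
IsNu v T = WeaklyTerminal v T

module Submission where

-- A coalgebra for ⟦ w ⊥ ⟧ answers one move a with a direction; playing it along a
-- whole tree of moves answers every t : A* w i, i.e. it extends to a coalgebra for
-- ⟦ (w *) ⊥ ⟧, so νintro supplies intro.  Conversely, restricting a ⟦ (w *) ⊥ ⟧-
-- structure to one-node trees yields a ⟦ w ⊥ ⟧-structure, which supplies elim.
-- Restriction is natural and undoes the extension, so the computation rule of ν
-- transports to the one for ⟦ w ⊥ ⟧.

open import Defs
open import Data.Unit using (tt)
open import Data.Product using (Σ; _,_; proj₁; proj₂)
open import Relation.Binary.PropositionalEquality using (_≡_; refl; cong; module ≡-Reasoning)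
open ≡-Reasoning

module _ {I : Set} (w : Container I) where

  playAlong : {X : Pred I} → X ⊆ ⟦ w ⊥ ⟧ X → (i : I) → X i → (t : A* w i) →
              Σ (D* w i t) λ d → X (n* w i t d)
  playAlong c i x Leaf = tt , x
  playAlong c i x (Node a k) =
    let d = proj₁ (c i x) a
        (d′ , y) = playAlong c (n w i a d) (proj₂ (c i x) a) (k d)
    in (d , d′) , y

  extend : {X : Pred I} → X ⊆ ⟦ w ⊥ ⟧ X → X ⊆ ⟦ (w *) ⊥ ⟧ X
  extend c i x = (λ t → proj₁ (playAlong c i x t)) , (λ t → proj₂ (playAlong c i x t))

  singleton : {i : I} → A w i → A* w i
  singleton a = Node a λ _ → Leaf

  restrict : {X : Pred I} → ⟦ (w *) ⊥ ⟧ X ⊆ ⟦ w ⊥ ⟧ X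
  restrict i (f , x) = (λ a → proj₁ (f (singleton a))) , (λ a → x (singleton a))

  restrict-natural : {X Y : Pred I} (h : X ⊆ Y) (i : I) (p : ⟦ (w *) ⊥ ⟧ X i) →
                     restrict {Y} i (⟦ (w *) ⊥ ⟧₁ h i p) ≡ ⟦ w ⊥ ⟧₁ h i (restrict {X} i p)
  restrict-natural h i p = refl

  restrict-extend : {X : Pred I} (c : X ⊆ ⟦ w ⊥ ⟧ X) (i : I) (x : X i) →
                    restrict {X} i (extend c i x) ≡ c i x
  restrict-extend c i x = refl

lemma4p7 : {I : Set} (w : Container I) (νw*⊥ : Pred I) → IsNu ((w *) ⊥) νw*⊥ →
    WeaklyTerminal (w ⊥) νw*⊥
lemma4p7 w T ν = record
  { elim  = λ i t → restrict w {T} i (elim i t)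
  ; intro = λ c → intro (extend w c)
  ; comp  = λ {X} c i x → begin
      restrict w {T} i (elim i (intro (extend w c) i x))
        ≡⟨ cong (restrict w {T} i) (comp (extend w c) i x) ⟩
      restrict w {T} i (⟦ (w *) ⊥ ⟧₁ (intro (extend w c)) i (extend w c i x))
        ≡⟨ restrict-natural w (intro (extend w c)) i (extend w c i x) ⟩
      ⟦ w ⊥ ⟧₁ (intro (extend w c)) i (restrict w {X} i (extend w c i x))
        ≡⟨ cong (⟦ w ⊥ ⟧₁ (intro (extend w c)) i) (restrict-extend w c i x) ⟩
      ⟦ w ⊥ ⟧₁ (intro (extend w c)) i (c i x)
        ∎
  }
  where open WeaklyTerminal ν
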